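{- Let $k_1,k_2\in\{1,2,\dots,\frac{\ell mn}{L}\}$. If some row of $A^{(k_1)}$ is also a row of $A^{(k_2)}$, then every row of $A^{(k_1)}$ is also a row of $A^{(k_2)}$.
   Context: Let $\ell,m,n\geq 2$ be integers, $L=\mathrm{lcm}(\ell,m,n)$ and $\lambda=\frac{n\cdot\mathrm{lcm}(\ell,m)}{L}$. Write $V(K_\ell)=\{u_1,\dots,u_\ell\}$, $V(K_m)=\{v_1,\dots,v_m\}$, $V(K_n)=\{w_1,\dots,w_n\}$, so vertices of $K_\ell\square K_m\square K_n$ are triples $(u_a,v_b,w_c)$. Let $\rho=(u_1\,u_2\,\cdots\,u_\ell)$, $\sigma=(v_1\,v_2\,\cdots\,v_m)$, $\tau=(w_1\,w_2\,\cdots\,w_n)$ be the cyclic permutations of the respective vertex sets. Define $L\times 3$ matrices $A^{(k)}=[\mathbf{c}^{(k)}\ \mathbf{d}^{(k)}\ \mathbf{e}^{(k)}]$ (columns) for $k=1,\dots,\frac{\ell mn}{L}$ as follows: row $r$ ($r=1,\dots,L$) of $A^{(1)}$ is $(\rho^{r-1}(u_1),\sigma^{r-1}(v_1),\tau^{r-1}(w_1))$; for $k>1$, $\mathbf{c}^{(k)}=\mathbf{c}^{(1)}$, and if $k\equiv 1\pmod{\lambda}$ then $\mathbf{d}^{(k)}=\sigma(\mathbf{d}^{(k-1)})$, $\mathbf{e}^{(k)}=\mathbf{e}^{(k-1)}$, while otherwise $\mathbf{d}^{(k)}=\mathbf{d}^{(k-1)}$, $\mathbf{e}^{(k)}=\tau(\mathbf{e}^{(k-1)})$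 (permutations applied entrywise). Each row is regarded as a vertex of $K_\ell\square K_m\square K_n$. -}

module Defs where

open import Data.Nat using (ℕ; zero; suc; _+_; _*_; _∸_; _≤_; NonZero; >-nonZero)
open import Data.Nat.Properties using (m*n≢0; m*n≢0⇒n≢0)
import Data.Nat.Properties
import Data.Nat
open import Data.Nat.DivMod using (_mod_; _/_)
open import Data.Nat.Divisibility using (_∣_; _∣?_)
open import Data.Nat.GCD using (gcd)
open import Data.Nat.LCM using (lcm; gcd*lcm)
open import Data.Fin using (Fin; toℕ)
open import Data.Product using (_×_; _,_)
open import Relation.Nullary using (yes; no)
open import Relation.Binary.PropositionalEquality using (subst; sym)

iter : ∀ {A : Set} → (A → A) → ℕ → A → A
iter f zero    x = x
iter f (suc k) x = f (iter f k x)

lcm-nonZero : ∀ a b .{{_ : NonZero a}} .{{_ : NonZero b}} → NonZero (lcm a b)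
lcm-nonZero a b =
  m*n≢0⇒n≢0 (gcd a b) {{subst NonZero (sym (gcd*lcm a b)) (m*n≢0 a b)}}

-- The construction of the paper, for fixed ℓ m n ≥ 2.
-- Vertex sets are indexed from 0: u_{a+1} ↦ (a : Fin ℓ), etc.
-- Rows are indexed from 0: row r ↦ (r-1 : Fin L).
module Construction (ℓ m n : ℕ) (hℓ : 2 ≤ ℓ) (hm : 2 ≤ m) (hn : 2 ≤ n) where

  instance
    nzℓ : NonZero ℓ
    nzℓ = >-nonZero hℓ'
      where hℓ' = Data.Nat.Properties.≤-trans (Data.Nat.s≤s Data.Nat.z≤n) hℓ
    nzm : NonZero m
    nzm = >-nonZero (Data.Nat.Properties.≤-trans (Data.Nat.s≤s Data.Nat.z≤n) hm)
    nzn : NonZero n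
    nzn = >-nonZero (Data.Nat.Properties.≤-trans (Data.Nat.s≤s Data.Nat.z≤n) hn)

  L : ℕ
  L = lcm ℓ (lcm m n)

  instance
    nzL : NonZero L
    nzL = lcm-nonZero ℓ (lcm m n) {{nzℓ}} {{lcm-nonZero m n}}

  lam : ℕ
  lam = (n * lcm ℓ m) / L

  K : ℕ
  K = (ℓ * m * n) / L

  -- vertices of K_ℓ □ K_m □ K_n
  Vertex : Set
  Vertex = Fin ℓ × Fin m × Fin n

  ρ : Fin ℓ → Fin ℓ
  ρ a = suc (toℕ a) mod ℓ
  σ : Fin m → Fin m
  σ b = suc (toℕ b) mod m
  τ : Fin n → Fin n
  τ c = suc (toℕ c) mod n

  u₁ : Fin ℓ
  u₁ = 0 mod ℓ
  v₁ : Fin m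
  v₁ = 0 mod m
  w₁ : Fin n
  w₁ = 0 mod n

  record Matrix : Set where
    constructor mat
    field
      c : Fin L → Fin ℓ
      d : Fin L → Fin m
      e : Fin L → Fin n

  row : Matrix → Fin L → Vertex
  row M r = Matrix.c M r , Matrix.d M r , Matrix.e M r

  A₁ : Matrix
  A₁ = mat (λ r → iter ρ (toℕ r) u₁) (λ r → iter σ (toℕ r) v₁) (λ r → iter τ (toℕ r) w₁)

  -- A⁽ᵏ⁾ for k ≥ 1; A 0 is an unused junk value (equal to A⁽¹⁾).
  step : ℕ → Matrix → Matrix
  step k M with lam ∣? (k ∸ 1)
  ... | yes _ = mat (Matrix.c A₁) (λ r → σ (Matrix.d M r)) (Matrix.e M)
  ... | no  _ = mat (Matrix.c A₁) (Matrix.d M) (λ r → τ (Matrix.e M r))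

  A : ℕ → Matrix
  A zero = A₁
  A (suc zero) = A₁
  A (suc (suc j)) = step (suc (suc j)) (A (suc j))

-- Every A⁽ᵏ⁾ is a "diagonal" matrix: its row r is (r, β + r, γ + r), read modulo (ℓ, m, n),
-- for some offsets β, γ depending on k, since each step only advances one offset. Such rows
-- are L-periodic in r, as ℓ, m, n ∣ L. So if row r₀ of A⁽ᵏ¹⁾ equals row s₀ of A⁽ᵏ²⁾, adding
-- the same t to r₀ and s₀ keeps the rows equal, and taking t ≡ r − r₀ (mod L) yields a
-- matching row for any r.
module Submission where

open import Defs
open import Data.Nat using (ℕ; zero; suc; _+_; _∸_; _≤_; NonZero)
open import Data.Nat.Properties using (+-assoc; +-identityʳ; +-suc; m+[n∸m]≡n; <⇒≤)
open import Data.Nat.DivMod using (_mod_; _%_; m%n<n; m%n%n≡m%n; %-distribˡ-+; %-remove-+ˡ; m∣n⇒o%n%m≡o%m)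
open import Data.Nat.Divisibility using (_∣_; ∣-trans; _∣?_)
open import Data.Nat.LCM using (lcm; m∣lcm[m,n]; n∣lcm[m,n])
open import Data.Fin using (Fin; toℕ)
open import Data.Fin.Properties using (toℕ-fromℕ<; toℕ-injective; toℕ<n)
open import Data.Product using (∃; ∃₂; _,_; proj₁; proj₂)
open import Relation.Nullary using (yes; no)
open import Function using (_∘_)
open import Relation.Binary.PropositionalEquality using (_≡_; refl; sym; trans; cong; cong₂; module ≡-Reasoning)
open ≡-Reasoning

module _ {p : ℕ} .{{_ : NonZero p}} where

  toℕ-mod : ∀ x → toℕ (x mod p) ≡ x % p
  toℕ-mod x = toℕ-fromℕ< (m%n<n x p)

  mod-≡⇒%-≡ : ∀ {x y} → x mod p ≡ y mod p → x % p ≡ y % p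
  mod-≡⇒%-≡ {x} {y} e = trans (sym (toℕ-mod x)) (trans (cong toℕ e) (toℕ-mod y))

  %-≡⇒mod-≡ : ∀ {x y} → x % p ≡ y % p → x mod p ≡ y mod p
  %-≡⇒mod-≡ {x} {y} e = toℕ-injective (trans (toℕ-mod x) (trans e (sym (toℕ-mod y))))

  mod-cong-+ : ∀ {x y u v} → x mod p ≡ y mod p → u mod p ≡ v mod p → (x + u) mod p ≡ (y + v) mod p
  mod-cong-+ {x} {y} {u} {v} x≡y u≡v = %-≡⇒mod-≡ (begin
    (x + u) % p           ≡⟨ %-distribˡ-+ x u p ⟩
    (x % p + u % p) % p   ≡⟨ cong₂ (λ a b → (a + b) % p) (mod-≡⇒%-≡ x≡y) (mod-≡⇒%-≡ u≡v) ⟩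
    (y % p + v % p) % p   ≡⟨ %-distribˡ-+ y v p ⟨
    (y + v) % p           ∎)

  toℕ-mod-mod : ∀ x → toℕ (x mod p) mod p ≡ x mod p
  toℕ-mod-mod x = %-≡⇒mod-≡ (trans (cong (_% p) (toℕ-mod x)) (m%n%n≡m%n x p))

  orbit : ℕ → ℕ → Fin p
  orbit a x = (a + x) mod p

  cycleStep : Fin p → Fin p
  cycleStep i = suc (toℕ i) mod p

  cycleStep-orbit : ∀ a x → cycleStep (orbit a x) ≡ orbit (suc a) x
  cycleStep-orbit a x = mod-cong-+ {1} refl (toℕ-mod-mod (a + x))

  iter-cycleStep : ∀ a x → iter cycleStep x (a mod p) ≡ orbit a x
  iter-cycleStep a zero    = cong (_mod p) (sym (+-identityʳ a))
  iter-cycleStep a (suc x) = begin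
    cycleStep (iter cycleStep x (a mod p))  ≡⟨ cong cycleStep (iter-cycleStep a x) ⟩
    cycleStep (orbit a x)                   ≡⟨ cycleStep-orbit a x ⟩
    orbit (suc a) x                         ≡⟨ cong (_mod p) (+-suc a x) ⟨
    orbit a (suc x)                         ∎

  orbit-shift : ∀ {a b x y} t → orbit a x ≡ orbit b y → orbit a (x + t) ≡ orbit b (y + t)
  orbit-shift {a} {b} {x} {y} t e = begin
    (a + (x + t)) mod p  ≡⟨ cong (_mod p) (+-assoc a x t) ⟨
    (a + x + t) mod p    ≡⟨ mod-cong-+ e refl ⟩
    (b + y + t) mod p    ≡⟨ cong (_mod p) (+-assoc b y t) ⟩
    (b + (y + t)) mod p  ∎

  module _ {q : ℕ} .{{_ : NonZero q}} (p∣q : p ∣ q) where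

    orbit-periodic : ∀ a x → orbit a (q + x) ≡ orbit a x
    orbit-periodic a x = mod-cong-+ {a} refl (%-≡⇒mod-≡ (%-remove-+ˡ x p∣q))

    orbit-% : ∀ a x → orbit a (x % q) ≡ orbit a x
    orbit-% a x = mod-cong-+ {a} refl (%-≡⇒mod-≡ (m∣n⇒o%n%m≡o%m p q x p∣q))

module Diagonal (ℓ m n : ℕ) (hℓ : 2 ≤ ℓ) (hm : 2 ≤ m) (hn : 2 ≤ n) where
  open Construction ℓ m n hℓ hm hn

  diagonal : ℕ → ℕ → ℕ → Vertex
  diagonal β γ t = orbit 0 t , orbit β t , orbit γ t

  record IsDiagonal (M : Matrix) (β γ : ℕ) : Set where
    field
      c-orbit : ∀ r → Matrix.c M r ≡ orbit 0 (toℕ r)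
      d-orbit : ∀ r → Matrix.d M r ≡ orbit β (toℕ r)
      e-orbit : ∀ r → Matrix.e M r ≡ orbit γ (toℕ r)

    row-diagonal : ∀ r → row M r ≡ diagonal β γ (toℕ r)
    row-diagonal r = cong₂ _,_ (c-orbit r) (cong₂ _,_ (d-orbit r) (e-orbit r))

  open IsDiagonal

  A₁-diagonal : IsDiagonal A₁ 0 0
  A₁-diagonal = record
    { c-orbit = λ r → iter-cycleStep 0 (toℕ r)
    ; d-orbit = λ r → iter-cycleStep 0 (toℕ r)
    ; e-orbit = λ r → iter-cycleStep 0 (toℕ r)
    }

  step-diagonal : ∀ k {M β γ} → IsDiagonal M β γ → ∃₂ λ β′ γ′ → IsDiagonal (step k M) β′ γ′
  step-diagonal k {M} {β} {γ} D with lam ∣? (k ∸ 1)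
  ... | yes _ = suc β , γ , record
    { c-orbit = c-orbit A₁-diagonal
    ; d-orbit = λ r → trans (cong σ (d-orbit D r)) (cycleStep-orbit β (toℕ r))
    ; e-orbit = e-orbit D
    }
  ... | no _ = β , suc γ , record
    { c-orbit = c-orbit A₁-diagonal
    ; d-orbit = d-orbit D
    ; e-orbit = λ r → trans (cong τ (e-orbit D r)) (cycleStep-orbit γ (toℕ r))
    }

  A-diagonal : ∀ k → ∃₂ λ β γ → IsDiagonal (A k) β γ
  A-diagonal zero          = 0 , 0 , A₁-diagonal
  A-diagonal (suc zero)    = 0 , 0 , A₁-diagonal
  A-diagonal (suc (suc j)) with A-diagonal (suc j)
  ... | _ , _ , D = step-diagonal (suc (suc j)) D

  ℓ∣L : ℓ ∣ L
  ℓ∣L = m∣lcm[m,n] ℓ (lcm m n)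

  m∣L : m ∣ L
  m∣L = ∣-trans (m∣lcm[m,n] m n) (n∣lcm[m,n] ℓ (lcm m n))

  n∣L : n ∣ L
  n∣L = ∣-trans (n∣lcm[m,n] m n) (n∣lcm[m,n] ℓ (lcm m n))

  diagonal-periodic : ∀ β γ t → diagonal β γ (L + t) ≡ diagonal β γ t
  diagonal-periodic β γ t =
    cong₂ _,_ (orbit-periodic ℓ∣L 0 t) (cong₂ _,_ (orbit-periodic m∣L β t) (orbit-periodic n∣L γ t))

  diagonal-% : ∀ β γ t → diagonal β γ (t % L) ≡ diagonal β γ t
  diagonal-% β γ t = cong₂ _,_ (orbit-% ℓ∣L 0 t) (cong₂ _,_ (orbit-% m∣L β t) (orbit-% n∣L γ t))

  diagonal-shift : ∀ {β₁ γ₁ β₂ γ₂ x y} t → diagonal β₁ γ₁ x ≡ diagonal β₂ γ₂ y →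
                   diagonal β₁ γ₁ (x + t) ≡ diagonal β₂ γ₂ (y + t)
  diagonal-shift {β₁} {γ₁} {β₂} {γ₂} {x} {y} t e =
    cong₂ _,_ (orbit-shift {a = 0} {0} {x} {y} t (cong proj₁ e))
      (cong₂ _,_ (orbit-shift {a = β₁} {β₂} {x} {y} t (cong (proj₁ ∘ proj₂) e))
                 (orbit-shift {a = γ₁} {γ₂} {x} {y} t (cong (proj₂ ∘ proj₂) e)))

  diagonal-match : ∀ {β₁ γ₁ β₂ γ₂} (r₀ s₀ : Fin L) → diagonal β₁ γ₁ (toℕ r₀) ≡ diagonal β₂ γ₂ (toℕ s₀) →
                   (r : Fin L) → ∃ λ (s : Fin L) → diagonal β₁ γ₁ (toℕ r) ≡ diagonal β₂ γ₂ (toℕ s)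
  diagonal-match {β₁} {γ₁} {β₂} {γ₂} r₀ s₀ e r = (s₀′ + t) mod L , (begin
    diagonal β₁ γ₁ r′                      ≡⟨ diagonal-periodic β₁ γ₁ r′ ⟨
    diagonal β₁ γ₁ (L + r′)                ≡⟨ cong (diagonal β₁ γ₁) r₀+t≡L+r ⟨
    diagonal β₁ γ₁ (r₀′ + t)               ≡⟨ diagonal-shift t e ⟩
    diagonal β₂ γ₂ (s₀′ + t)               ≡⟨ diagonal-% β₂ γ₂ (s₀′ + t) ⟨
    diagonal β₂ γ₂ ((s₀′ + t) % L)         ≡⟨ cong (diagonal β₂ γ₂) (toℕ-mod {p = L} (s₀′ + t)) ⟨
    diagonal β₂ γ₂ (toℕ ((s₀′ + t) mod L)) ∎)
    where
    r₀′ = toℕ r₀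
    s₀′ = toℕ s₀
    r′ = toℕ r
    t = L ∸ r₀′ + r′
    r₀+t≡L+r : r₀′ + t ≡ L + r′
    r₀+t≡L+r = trans (sym (+-assoc r₀′ (L ∸ r₀′) r′)) (cong (_+ r′) (m+[n∸m]≡n {n = L} (<⇒≤ (toℕ<n r₀))))

  rows-match : ∀ {M₁ M₂ β₁ γ₁ β₂ γ₂} → IsDiagonal M₁ β₁ γ₁ → IsDiagonal M₂ β₂ γ₂ →
               (∃ λ (r : Fin L) → ∃ λ (s : Fin L) → row M₁ r ≡ row M₂ s) →
               (r : Fin L) → ∃ λ (s : Fin L) → row M₁ r ≡ row M₂ s
  rows-match D₁ D₂ (r₀ , s₀ , row₁≡row₂) r =
    let s , diagonal₁≡diagonal₂ = diagonal-match r₀ s₀ (trans (sym (row-diagonal D₁ r₀))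
                                                        (trans row₁≡row₂ (row-diagonal D₂ s₀))) r
    in s , trans (row-diagonal D₁ r) (trans diagonal₁≡diagonal₂ (sym (row-diagonal D₂ s)))

mainTheorem4 : (ℓ m n : ℕ) (hℓ : 2 ≤ ℓ) (hm : 2 ≤ m) (hn : 2 ≤ n) →
    let open Construction ℓ m n hℓ hm hn in
    (k₁ k₂ : ℕ) → 1 ≤ k₁ → k₁ ≤ K → 1 ≤ k₂ → k₂ ≤ K →
    (∃ λ (r : Fin L) → ∃ λ (s : Fin L) → row (A k₁) r ≡ row (A k₂) s) →
    (r : Fin L) → ∃ λ (s : Fin L) → row (A k₁) r ≡ row (A k₂) s
mainTheorem4 ℓ m n hℓ hm hn k₁ k₂ _ _ _ _ =
  rows-match (proj₂ (proj₂ (A-diagonal k₁))) (proj₂ (proj₂ (A-diagonal k₂)))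
  where open Diagonal ℓ m n hℓ hm hn
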